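{- For every integer $n>2$ there exist a signed group $S$ and a signed group orthogonal design $SOD\big(2^n;\,1_{(2^n)},S\big)$ (i.e. of order $2^n$ and type $(1,1,\dots,1)$ with $2^n$ ones) such that $S$ admits a remrep (real monomial representation) of degree $2^{2^{n-1}-1}$.
   Context: A signed group is a group $S$ together with a distinguished central element of order two, denoted $-1$ (the unit is denoted $1$). Let $\varrho$ be a transversal of $\langle -1\rangle$ in $S$. The signed group ring $\mathbb{R}[S]$ consists of formal sums $\sum_i s_i r_i$ with $s_i\in\varrho$, $r_i\in\mathbb{R}$, where one identifies $(-s)r=s(-r)$ for $s\in\varrho$; addition is termwise and multiplication is by linear extension. Conjugation is $\overline{\sum_i s_i r_i}=\sum_i s_i^{ -1} r_i$. A signed group orthogonal design of order $n$ and type $(u_1,\dots,u_k)$ over $S$, denoted $SOD(n;\,u_1,\dots,u_k,S)$, is an $n\times n$ matrix $X$ each of whose entries is either $0$ or of the form $\epsilon x_i$ with $\epsilon\in S$ and $x_1,\dots,x_k$ commuting variables, such that $XX^*=\big(\sum_{i=1}^k u_i x_i^2\big)I_n$, where the $u_i$ are positive integers, $X^*$ is the conjugate transpose (the conjugate of $\epsilon x_i$ being $\epsilon^{ -1}x_i$), and matrix operations are over $\mathbb{R}[S]$. The notation $u_{(k)}$ means $u$ repeated $k$ times. Let $SP_m$ denote the group of $m\times m$ monomial matrices with nonzero entries in $\{\pm1\}$, regarded as a signed group with distinguished element $-I_m$. A remrep of degree $m$ of a signed group $S$ is a map $\phi:S\to SP_m$ with $\phi(ab)=\phi(a)\phi(b)$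 for all $a,b\in S$ and $\phi(-1)=-I_m$. -}

module Defs where

open import Level using (Level; 0ℓ; _⊔_) renaming (suc to lsuc)
open import Algebra.Bundles using (Group)
open import Data.Nat as ℕ using (ℕ; zero; suc; _≤ᵇ_)
open import Data.Bool using (Bool; true; false; if_then_else_)
open import Data.Integer as ℤ using (ℤ; +_; -_)
open import Data.Fin using (Fin; toℕ)
open import Data.Fin.Properties using (_≟_)
open import Data.List using (List; []; _∷_; concatMap; allFin)
open import Data.List.Relation.Binary.Permutation.Propositional using (_↭_)
open import Data.Maybe using (Maybe; just; nothing)
open import Data.Product using (Σ; ∃; _×_; _,_)
open import Data.Sum using (_⊎_)
open import Relation.Nullary using (¬_; does)
open import Relation.Binary.PropositionalEquality using (_≡_; _≢_)

record SignedGroup (c ℓ : Level) : Set (lsuc (c ⊔ ℓ)) where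
  field
    group : Group c ℓ
  open Group group public
  field
    -1g       : Carrier
    -1g²      : (-1g ∙ -1g) ≈ ε
    -1g≉ε     : ¬ (-1g ≈ ε)
    -1g-central : ∀ x → (-1g ∙ x) ≈ (x ∙ -1g)

-- An element is a formal sum  Σ s_i r_i  given as a list of pairs
-- (s_i , r_i).

module SignedGroupRing {c ℓ} (S : SignedGroup c ℓ) where
  open SignedGroup S

  RS : Set c
  RS = List (Carrier × ℤ)

  data _~_ : RS → RS → Set (c ⊔ ℓ) where
    ~-refl  : ∀ {L} → L ~ L
    ~-sym   : ∀ {L L'} → L ~ L' → L' ~ L
    ~-trans : ∀ {L L' L''} → L ~ L' → L' ~ L'' → L ~ L''
    ~-perm  : ∀ {L L'} → L ↭ L' → L ~ L'
    ~-∷     : ∀ {x L L'} → L ~ L' → (x ∷ L) ~ (x ∷ L')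
    ~-el    : ∀ {s t r L} → s ≈ t → ((s , r) ∷ L) ~ ((t , r) ∷ L)
    ~-sign  : ∀ {s r L} → ((-1g ∙ s , r) ∷ L) ~ ((s , - r) ∷ L)
    ~-merge : ∀ {s a b L} → ((s , a) ∷ (s , b) ∷ L) ~ ((s , a ℤ.+ b) ∷ L)
    ~-zero  : ∀ {s L} → ((s , + 0) ∷ L) ~ L

-- Signed group orthogonal designs.
-- An entry is 0 (nothing) or  ε x_i  (just (ε , i)).

module SOD-Defs {c ℓ} (S : SignedGroup c ℓ) where
  open SignedGroup S
  open SignedGroupRing S

  Entry : ℕ → Set c
  Entry k = Maybe (Carrier × Fin k)

  Mat : ℕ → ℕ → Set c
  Mat n k = Fin n → Fin n → Entry k

  -- the monomial x_p x_q, normalised as an ordered pair (min , max)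
  sameMonomial : ∀ {k} → Fin k → Fin k → Fin k → Fin k → Bool
  sameMonomial p q i j =
    if toℕ p ℕ.≤ᵇ toℕ q
    then (does (p ≟ i) Data.Bool.∧ does (q ≟ j))
    else (does (q ≟ i) Data.Bool.∧ does (p ≟ j))

  -- contribution of the product  X_ac · (X_bc)^*  to the coefficient of
  -- the monomial x_i x_j  (i ≤ j); (ε x_p)(ε' x_q)^* = ε ε'⁻¹ x_p x_q
  term : ∀ {k} → Entry k → Entry k → Fin k → Fin k → RS
  term (just (e , p)) (just (e' , q)) i j =
    if sameMonomial p q i j then (e ∙ e' ⁻¹ , + 1) ∷ [] else []
  term _ _ _ _ = []

  coeffXX* : ∀ {n k} → Mat n k → Fin n → Fin n → Fin k → Fin k → RS
  coeffXX* {n} X a b i j = concatMap (λ c' → term (X a c') (X b c') i j) (allFin n)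

  coeffTarget : ∀ {n k} → (Fin k → ℕ) → Fin n → Fin n → Fin k → Fin k → RS
  coeffTarget u a b i j =
    if does (a ≟ b) Data.Bool.∧ does (i ≟ j) then (ε , + u i) ∷ [] else []

  -- X is an SOD(n; u_1,…,u_k, S):  X X^* = (Σ u_i x_i²) I_n  as matrices
  -- over ℝ[S][x_1,…,x_k] (commuting variables), i.e. coefficientwise.
  IsSOD : (n k : ℕ) → (Fin k → ℕ) → Mat n k → Set (c ⊔ ℓ)
  IsSOD n k u X =
    (∀ i → 0 ℕ.< u i) ×
    (∀ a b (i j : Fin k) → toℕ i ℕ.≤ toℕ j →
       coeffXX* X a b i j ~ coeffTarget u a b i j)

IntMat : ℕ → Set
IntMat m = Fin m → Fin m → ℤ

sumFin : ∀ m → (Fin m → ℤ) → ℤ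
sumFin zero f = + 0
sumFin (suc m) f = f Fin.zero ℤ.+ sumFin m (λ i → f (Fin.suc i))
  where import Data.Fin as Fin

_⊗_ : ∀ {m} → IntMat m → IntMat m → IntMat m
(A ⊗ B) i j = sumFin _ (λ l → A i l ℤ.* B l j)

negI : ∀ m → IntMat m
negI m i j = if does (i ≟ j) then - (+ 1) else + 0

IsSP : ∀ m → IntMat m → Set
IsSP m M =
  (∀ i → ∃ λ j → (M i j ≡ + 1 ⊎ M i j ≡ - (+ 1)) × (∀ j' → j' ≢ j → M i j' ≡ + 0)) ×
  (∀ j → ∃ λ i → (M i j ≡ + 1 ⊎ M i j ≡ - (+ 1)) × (∀ i' → i' ≢ i → M i' j ≡ + 0))

SP : ℕ → Set
SP m = Σ (IntMat m) (IsSP m)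

record Remrep {c ℓ} (S : SignedGroup c ℓ) (m : ℕ) : Set (c ⊔ ℓ) where
  open SignedGroup S
  field
    φ       : Carrier → IntMat m
    φ-SP    : ∀ a → IsSP m (φ a)
    φ-cong  : ∀ {a b} → a ≈ b → ∀ i j → φ a i j ≡ φ b i j
    φ-hom   : ∀ a b i j → φ (a ∙ b) i j ≡ (φ a ⊗ φ b) i j
    φ-neg   : ∀ i j → φ -1g i j ≡ negI m i j

module Submission where

-- Write n = 3 + t and k = dim t = 2 ^ (t + 2) - 1.  S is the Pauli group of
-- rank k: triples (s , x , z) with s ∈ F₂, x , z ∈ F₂ᵏ, standing for
-- (-1)ˢ XˣZᶻ.  Its action on F₂ᵏ ≅ Fin (2 ^ k) by signed translations is a
-- remrep of degree 2 ^ k.  The design is group developed over F₂ⁿ: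
-- X_ac = α_(a+c) x_(a+c).  It is orthogonal as soon as every quotient
-- α_p α_q⁻¹ (p ≠ q) squares to -1 (this works in any signed group), and in
-- the Pauli group that holds when the labels u , v of any two distinct α_p
-- satisfy Q(u + v) = 1 for the quadratic form Q(x , z) = z·x.  Such a family of 2 ^ (t + 3) labels on k
-- qubits is built from an explicit family of 8 labels on 3 qubits by
-- repeatedly doubling the family at the cost of k ↦ 2k + 1 qubits.

open import Defs
open import Data.Maybe using (just)
open import Level using (0ℓ)
open import Algebra.Bundles using (Group; CommutativeMonoid; CommutativeRing)
open import Data.Bool using (Bool; true; false; _xor_; _∧_; _∨_; if_then_else_; T)
open import Data.Bool.Properties
  using (xor-assoc; xor-comm; xor-identityˡ; xor-identityʳ; xor-same; ∧-distribˡ-xor; ∧-distribʳ-xor; ∧-zeroʳ; xor-∧-commutativeRing; T-∧; T-∨; T-≡)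
open import Data.Empty using (⊥-elim)
open import Data.Unit using (tt)
open import Data.Fin using (Fin; toℕ; combine; remQuot)
import Data.Fin as Fin
open import Data.Fin.Properties using (_≟_; remQuot-combine; combine-remQuot; suc-injective; toℕ-injective)
open import Data.Integer using (ℤ; +_; -_)
import Data.Integer as ℤ using (_+_; _*_)
import Data.Integer.Properties as ℤP
open import Data.Nat using (ℕ; zero; suc; _≤_; _<_; _≤ᵇ_; _^_; _∸_; _+_; s≤s; z≤n)
import Data.Nat.Properties as ℕ
open import Data.Product using (Σ; ∃; _×_; _,_; proj₁; proj₂)
open import Data.Sum using (_⊎_; inj₁; inj₂)
import Data.List as List
open import Data.List using ([]; _∷_; concatMap; tabulate)
open import Data.List.Relation.Binary.Permutation.Propositional.Properties using (++⁺ʳ)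
open import Data.Vec using (Vec; []; _∷_; zipWith; replicate; _++_)
open import Data.Vec.Properties using (zipWith-assoc; zipWith-comm; zipWith-identityˡ; zipWith-identityʳ)
import Data.Vec.Properties as Vec
open import Function using (_∘_)
open import Function.Bundles using (Equivalence)
open import Relation.Binary.PropositionalEquality
  using (_≡_; _≢_; refl; sym; trans; cong; cong₂; subst; isEquivalence; module ≡-Reasoning)
open import Relation.Nullary using (¬_; Dec; yes; no; does)
open import Relation.Nullary.Decidable using (dec-true)

xor-commutativeMonoid : CommutativeMonoid 0ℓ 0ℓ
xor-commutativeMonoid = CommutativeRing.+-commutativeMonoid xor-∧-commutativeRing

open import Algebra.Solver.CommutativeMonoid xor-commutativeMonoid using (solve; _⊜_) renaming (_⊕_ to _⊞_)

infixl 6 _⊕_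

_⊕_ : ∀ {k} → Vec Bool k → Vec Bool k → Vec Bool k
_⊕_ = zipWith _xor_

0v : ∀ {k} → Vec Bool k
0v = replicate _ false

⊕-assoc : ∀ {k} (x y z : Vec Bool k) → (x ⊕ y) ⊕ z ≡ x ⊕ (y ⊕ z)
⊕-assoc = zipWith-assoc xor-assoc

⊕-comm : ∀ {k} (x y : Vec Bool k) → x ⊕ y ≡ y ⊕ x
⊕-comm = zipWith-comm xor-comm

⊕-identityˡ : ∀ {k} (x : Vec Bool k) → 0v ⊕ x ≡ x
⊕-identityˡ = zipWith-identityˡ xor-identityˡ

⊕-identityʳ : ∀ {k} (x : Vec Bool k) → x ⊕ 0v ≡ x
⊕-identityʳ = zipWith-identityʳ xor-identityʳ

⊕-self : ∀ {k} (x : Vec Bool k) → x ⊕ x ≡ 0v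
⊕-self []      = refl
⊕-self (a ∷ x) = cong₂ _∷_ (xor-same a) (⊕-self x)

⊕-cancelˡ : ∀ {k} (x v : Vec Bool k) → x ⊕ (x ⊕ v) ≡ v
⊕-cancelˡ x v = begin
  x ⊕ (x ⊕ v) ≡⟨ ⊕-assoc x x v ⟨
  (x ⊕ x) ⊕ v ≡⟨ cong (_⊕ v) (⊕-self x) ⟩
  0v ⊕ v      ≡⟨ ⊕-identityˡ v ⟩
  v           ∎
  where open ≡-Reasoning

⊕-injectiveˡ : ∀ {k} {x y : Vec Bool k} (v : Vec Bool k) → x ⊕ v ≡ y ⊕ v → x ≡ y
⊕-injectiveˡ {x = x} {y} v eq = begin
  x           ≡⟨ ⊕-cancelˡ v x ⟨
  v ⊕ (v ⊕ x) ≡⟨ cong (v ⊕_) (trans (⊕-comm v x) (trans eq (⊕-comm y v))) ⟩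
  v ⊕ (v ⊕ y) ≡⟨ ⊕-cancelˡ v y ⟩
  y           ∎
  where open ≡-Reasoning

⊕-++ : ∀ {m n} (x y : Vec Bool m) (x' y' : Vec Bool n) → (x ++ x') ⊕ (y ++ y') ≡ (x ⊕ y) ++ (x' ⊕ y')
⊕-++ []      []      x' y' = refl
⊕-++ (a ∷ x) (b ∷ y) x' y' = cong ((a xor b) ∷_) (⊕-++ x y x' y')

dot : ∀ {k} → Vec Bool k → Vec Bool k → Bool
dot []      []      = false
dot (a ∷ x) (b ∷ y) = (a ∧ b) xor dot x y

xor-interchange : ∀ a b c d → (a xor b) xor (c xor d) ≡ (a xor c) xor (b xor d)
xor-interchange = solve 4 (λ a b c d → (a ⊞ b) ⊞ (c ⊞ d) ⊜ (a ⊞ c) ⊞ (b ⊞ d)) refl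

dot-⊕ˡ : ∀ {k} (x y z : Vec Bool k) → dot (x ⊕ y) z ≡ dot x z xor dot y z
dot-⊕ˡ []      []      []      = refl
dot-⊕ˡ (a ∷ x) (b ∷ y) (c ∷ z) =
  trans (cong₂ _xor_ (∧-distribʳ-xor c a b) (dot-⊕ˡ x y z)) (xor-interchange (a ∧ c) (b ∧ c) _ _)

dot-⊕ʳ : ∀ {k} (x y z : Vec Bool k) → dot x (y ⊕ z) ≡ dot x y xor dot x z
dot-⊕ʳ []      []      []      = refl
dot-⊕ʳ (a ∷ x) (b ∷ y) (c ∷ z) =
  trans (cong₂ _xor_ (∧-distribˡ-xor a b c) (dot-⊕ʳ x y z)) (xor-interchange (a ∧ b) (a ∧ c) _ _)

dot-0ˡ : ∀ {k} (x : Vec Bool k) → dot 0v x ≡ false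
dot-0ˡ []      = refl
dot-0ˡ (a ∷ x) = dot-0ˡ x

dot-0ʳ : ∀ {k} (x : Vec Bool k) → dot x 0v ≡ false
dot-0ʳ []      = refl
dot-0ʳ (a ∷ x) = cong₂ _xor_ (∧-zeroʳ a) (dot-0ʳ x)

dot-++ : ∀ {m n} (x y : Vec Bool m) (x' y' : Vec Bool n) → dot (x ++ x') (y ++ y') ≡ dot x y xor dot x' y'
dot-++ []      []      x' y' = refl
dot-++ (a ∷ x) (b ∷ y) x' y' = trans (cong ((a ∧ b) xor_) (dot-++ x y x' y')) (sym (xor-assoc (a ∧ b) _ _))

-- Binary encoding: Fin (2 ^ k) ≅ F₂ᵏ, most significant bit first.

bit : Bool → Fin 2
bit false = Fin.zero
bit true  = Fin.suc Fin.zero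

unbit : Fin 2 → Bool
unbit Fin.zero    = false
unbit (Fin.suc _) = true

bit-unbit : ∀ i → bit (unbit i) ≡ i
bit-unbit Fin.zero           = refl
bit-unbit (Fin.suc Fin.zero) = refl

unbit-bit : ∀ b → unbit (bit b) ≡ b
unbit-bit false = refl
unbit-bit true  = refl

toBits : ∀ {k} → Fin (2 ^ k) → Vec Bool k
toBits {zero}  _ = []
toBits {suc k} i = unbit (proj₁ (remQuot {2} (2 ^ k) i)) ∷ toBits (proj₂ (remQuot {2} (2 ^ k) i))

fromBits : ∀ {k} → Vec Bool k → Fin (2 ^ k)
fromBits []      = Fin.zero
fromBits (b ∷ v) = combine (bit b) (fromBits v)

fromBits-toBits : ∀ {k} (i : Fin (2 ^ k)) → fromBits (toBits {k} i) ≡ i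
fromBits-toBits {zero}  Fin.zero = refl
fromBits-toBits {suc k} i =
  trans (cong₂ combine (bit-unbit (proj₁ q)) (fromBits-toBits {k} (proj₂ q))) (combine-remQuot {2} (2 ^ k) i)
  where q = remQuot {2} (2 ^ k) i

toBits-fromBits : ∀ {k} (v : Vec Bool k) → toBits (fromBits v) ≡ v
toBits-fromBits []              = refl
toBits-fromBits {suc k} (b ∷ v) =
  cong₂ _∷_ (trans (cong (unbit ∘ proj₁) split) (unbit-bit b))
            (trans (cong (toBits ∘ proj₂) split) (toBits-fromBits v))
  where split = remQuot-combine {2} {2 ^ k} (bit b) (fromBits v)

toBits-injective : ∀ {k} {i j : Fin (2 ^ k)} → toBits {k} i ≡ toBits j → i ≡ j
toBits-injective {k} {i} {j} eq = trans (sym (fromBits-toBits {k} i)) (trans (cong fromBits eq) (fromBits-toBits {k} j))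

-- F₂ᵏ acts simply transitively on Fin (2 ^ k) by translation.  This action
-- provides both the permutation part of the Pauli matrices and the
-- group-developed shape of the orthogonal design.
translate : ∀ {k} → Vec Bool k → Fin (2 ^ k) → Fin (2 ^ k)
translate x w = fromBits (x ⊕ toBits w)

toBits-translate : ∀ {k} (x : Vec Bool k) w → toBits (translate x w) ≡ x ⊕ toBits w
toBits-translate x w = toBits-fromBits (x ⊕ toBits w)

translate-0 : ∀ {k} (w : Fin (2 ^ k)) → translate (0v {k}) w ≡ w
translate-0 {k} w = trans (cong fromBits (⊕-identityˡ (toBits {k} w))) (fromBits-toBits {k} w)

translate-∘ : ∀ {k} (x y : Vec Bool k) w → translate x (translate y w) ≡ translate (x ⊕ y) w
translate-∘ {k} x y w = cong fromBits (begin
  x ⊕ toBits (translate y w) ≡⟨ cong (x ⊕_) (toBits-translate y w) ⟩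
  x ⊕ (y ⊕ toBits w)         ≡⟨ ⊕-assoc x y (toBits {k} w) ⟨
  (x ⊕ y) ⊕ toBits w         ∎)
  where open ≡-Reasoning

translate-involutive : ∀ {k} (x : Vec Bool k) w → translate x (translate x w) ≡ w
translate-involutive {k} x w = trans (translate-∘ x x w) (trans (cong (λ y → translate y w) (⊕-self x)) (translate-0 {k} w))

translate-flip : ∀ {k} {x : Vec Bool k} {u w} → u ≡ translate x w → translate x u ≡ w
translate-flip {x = x} {w = w} refl = translate-involutive x w

translate-free : ∀ {k} {x y : Vec Bool k} w → translate x w ≡ translate y w → x ≡ y
translate-free {k} {x} {y} w eq = ⊕-injectiveˡ (toBits {k} w)
  (trans (sym (toBits-translate x w)) (trans (cong toBits eq) (toBits-translate y w)))

-- A pair u = (x , z) ∈ F₂ᵏ × F₂ᵏ labels the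
-- operator XˣZᶻ; since Zᶻ Xˣ' = (-1)^(z·x') Xˣ' Zᶻ, the sign picked up when
-- multiplying two labelled operators is the cocycle β(u , u') = z·x'.

Sym : ℕ → Set
Sym k = Vec Bool k × Vec Bool k

infixl 6 _⊕S_

_⊕S_ : ∀ {k} → Sym k → Sym k → Sym k
u ⊕S v = proj₁ u ⊕ proj₁ v , proj₂ u ⊕ proj₂ v

0S : ∀ {k} → Sym k
0S = 0v , 0v

β : ∀ {k} → Sym k → Sym k → Bool
β u v = dot (proj₂ u) (proj₁ v)

-- The quadratic form refining β: XˣZᶻ squares to (-1)^Q(x , z).
Q : ∀ {k} → Sym k → Bool
Q u = β u u

⊕S-comm : ∀ {k} (u v : Sym k) → u ⊕S v ≡ v ⊕S u
⊕S-comm u v = cong₂ _,_ (⊕-comm (proj₁ u) (proj₁ v)) (⊕-comm (proj₂ u) (proj₂ v))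

⊕S-assoc : ∀ {k} (u v w : Sym k) → (u ⊕S v) ⊕S w ≡ u ⊕S (v ⊕S w)
⊕S-assoc u v w = cong₂ _,_ (⊕-assoc (proj₁ u) (proj₁ v) (proj₁ w)) (⊕-assoc (proj₂ u) (proj₂ v) (proj₂ w))

⊕S-identityˡ : ∀ {k} (u : Sym k) → 0S ⊕S u ≡ u
⊕S-identityˡ u = cong₂ _,_ (⊕-identityˡ (proj₁ u)) (⊕-identityˡ (proj₂ u))

⊕S-identityʳ : ∀ {k} (u : Sym k) → u ⊕S 0S ≡ u
⊕S-identityʳ u = cong₂ _,_ (⊕-identityʳ (proj₁ u)) (⊕-identityʳ (proj₂ u))

⊕S-self : ∀ {k} (u : Sym k) → u ⊕S u ≡ 0S
⊕S-self u = cong₂ _,_ (⊕-self (proj₁ u)) (⊕-self (proj₂ u))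

β-0ˡ : ∀ {k} (u : Sym k) → β 0S u ≡ false
β-0ˡ u = dot-0ˡ (proj₁ u)

β-0ʳ : ∀ {k} (u : Sym k) → β u 0S ≡ false
β-0ʳ u = dot-0ʳ (proj₂ u)

-- (s , u) stands for (-1)ˢ XˣZᶻ; _·_ below is the operator product.
Pauli : ℕ → Set
Pauli k = Bool × Sym k

module _ {k : ℕ} where

  infixl 7 _·_

  _·_ : Pauli k → Pauli k → Pauli k
  (s , u) · (t , v) = (s xor t) xor β u v , u ⊕S v

  one : Pauli k
  one = false , 0S

  sign : Bool → Pauli k
  sign b = b , 0S

  inverse : Pauli k → Pauli k
  inverse (s , u) = s xor Q u , u

  ·-assoc : ∀ a b c → (a · b) · c ≡ a · (b · c)
  ·-assoc (s , u) (t , v) (r , w) = cong₂ _,_ signs (⊕S-assoc u v w)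
    where
    signs : (((s xor t) xor β u v) xor r) xor β (u ⊕S v) w ≡ (s xor ((t xor r) xor β v w)) xor β u (v ⊕S w)
    signs rewrite dot-⊕ˡ (proj₂ u) (proj₂ v) (proj₁ w) | dot-⊕ʳ (proj₂ u) (proj₁ v) (proj₁ w) =
      solve 6 (λ s t uv r uw vw → (((s ⊞ t) ⊞ uv) ⊞ r) ⊞ (uw ⊞ vw) ⊜ (s ⊞ ((t ⊞ r) ⊞ vw)) ⊞ (uv ⊞ uw))
        refl s t (β u v) r (β u w) (β v w)

  ·-identityˡ : ∀ a → one · a ≡ a
  ·-identityˡ (s , u) = cong₂ _,_ (trans (cong (s xor_) (β-0ˡ u)) (xor-identityʳ s)) (⊕S-identityˡ u)

  ·-identityʳ : ∀ a → a · one ≡ a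
  ·-identityʳ (s , u) = cong₂ _,_ (trans (cong ((s xor false) xor_) (β-0ʳ u)) (trans (xor-identityʳ _) (xor-identityʳ s))) (⊕S-identityʳ u)

  ·-inverseˡ : ∀ a → inverse a · a ≡ one
  ·-inverseˡ (s , u) = cong₂ _,_ cancel (⊕S-self u)
    where
    cancel : ((s xor Q u) xor s) xor Q u ≡ false
    cancel = trans (solve 2 (λ s q → ((s ⊞ q) ⊞ s) ⊞ q ⊜ (s ⊞ s) ⊞ (q ⊞ q)) refl s (Q u))
                   (cong₂ _xor_ (xor-same s) (xor-same (Q u)))

  ·-inverseʳ : ∀ a → a · inverse a ≡ one
  ·-inverseʳ (s , u) = cong₂ _,_ cancel (⊕S-self u)
    where
    cancel : (s xor (s xor Q u)) xor Q u ≡ false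
    cancel = trans (solve 2 (λ s q → (s ⊞ (s ⊞ q)) ⊞ q ⊜ (s ⊞ s) ⊞ (q ⊞ q)) refl s (Q u))
                   (cong₂ _xor_ (xor-same s) (xor-same (Q u)))

  sign-central : ∀ b a → sign b · a ≡ a · sign b
  sign-central b (s , u) =
    cong₂ _,_ (trans (cong ((b xor s) xor_) (β-0ˡ u))
                (trans (cong (_xor false) (xor-comm b s)) (cong ((s xor b) xor_) (sym (β-0ʳ u)))))
              (trans (⊕S-identityˡ u) (sym (⊕S-identityʳ u)))

  square : ∀ (a : Pauli k) → a · a ≡ sign (Q (proj₂ a))
  square (s , u) = cong₂ _,_ (cong (_xor Q u) (xor-same s)) (⊕S-self u)

  quotient-square : ∀ s t (u v : Sym k) → Q (u ⊕S v) ≡ true →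
                    ((s , u) · inverse (t , v)) · ((s , u) · inverse (t , v)) ≡ sign true
  quotient-square s t u v anticommute = trans (square ((s , u) · inverse (t , v))) (cong sign anticommute)

  pauliGroup : Group 0ℓ 0ℓ
  pauliGroup = record
    { Carrier = Pauli k ; _≈_ = _≡_ ; _∙_ = _·_ ; ε = one ; _⁻¹ = inverse
    ; isGroup = record
      { isMonoid = record
        { isSemigroup = record
          { isMagma = record { isEquivalence = isEquivalence ; ∙-cong = cong₂ _·_ }
          ; assoc = ·-assoc }
        ; identity = ·-identityˡ , ·-identityʳ }
      ; inverse = ·-inverseˡ , ·-inverseʳ
      ; ⁻¹-cong = cong inverse } }

  pauliSigned : SignedGroup 0ℓ 0ℓ
  pauliSigned = record
    { group       = pauliGroup
    ; -1g         = sign true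
    ; -1g²        = trans (square (sign true)) (cong sign (β-0ˡ (0S {k})))
    ; -1g≉ε       = λ ()
    ; -1g-central = sign-central true
    }

sumFin-single : ∀ m (f : Fin m → ℤ) l → (∀ l' → l' ≢ l → f l' ≡ + 0) → sumFin m f ≡ f l
sumFin-single (suc m) f Fin.zero vanish =
  trans (cong₂ ℤ._+_ (refl {x = f Fin.zero}) (sumFin-zero m (f ∘ Fin.suc) (λ l' → vanish (Fin.suc l') λ ())))
        (ℤP.+-identityʳ (f Fin.zero))
  where
  sumFin-zero : ∀ m (g : Fin m → ℤ) → (∀ l → g l ≡ + 0) → sumFin m g ≡ + 0
  sumFin-zero zero    g zeros = refl
  sumFin-zero (suc m) g zeros = cong₂ ℤ._+_ (zeros Fin.zero) (sumFin-zero m (g ∘ Fin.suc) (zeros ∘ Fin.suc))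
sumFin-single (suc m) f (Fin.suc l) vanish =
  trans (cong₂ ℤ._+_ (vanish Fin.zero λ ())
                 (sumFin-single m (f ∘ Fin.suc) l λ l' ne → vanish (Fin.suc l') (ne ∘ suc-injective)))
        (ℤP.+-identityˡ (f (Fin.suc l)))

if-yes : ∀ {P : Set} {A : Set} (d : Dec P) {x y : A} → P → (if does d then x else y) ≡ x
if-yes (yes _) _ = refl
if-yes (no ¬p) p = ⊥-elim (¬p p)

if-no : ∀ {P : Set} {A : Set} (d : Dec P) {x y : A} → ¬ P → (if does d then x else y) ≡ y
if-no (yes p) ¬p = ⊥-elim (¬p p)
if-no (no _)  _  = refl

sgn : Bool → ℤ
sgn false = + 1
sgn true  = - (+ 1)

sgn-xor : ∀ a b → sgn a ℤ.* sgn b ≡ sgn (a xor b)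
sgn-xor false false = refl
sgn-xor false true  = refl
sgn-xor true  false = refl
sgn-xor true  true  = refl

IsUnit : ℤ → Set
IsUnit v = v ≡ + 1 ⊎ v ≡ - (+ 1)

sgn-unit : ∀ a → IsUnit (sgn a)
sgn-unit false = inj₁ refl
sgn-unit true  = inj₂ refl

module PauliRepresentation (k : ℕ) where

  matrix : Pauli k → IntMat (2 ^ k)
  matrix (s , x , z) u w = if does (u ≟ translate x w) then sgn (s xor dot z (toBits w)) else + 0

  matrix-on : ∀ s x z {u} w → u ≡ translate x w → matrix (s , x , z) u w ≡ sgn (s xor dot z (toBits w))
  matrix-on s x z {u} w = if-yes (u ≟ translate x w)

  matrix-off : ∀ s x z {u} w → u ≢ translate x w → matrix (s , x , z) u w ≡ + 0
  matrix-off s x z {u} w = if-no (u ≟ translate x w)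

  matrix-SP : ∀ a → IsSP (2 ^ k) (matrix a)
  matrix-SP (s , x , z) = row , column
    where
    M : IntMat (2 ^ k)
    M = matrix (s , x , z)
    row : ∀ u → ∃ λ w → IsUnit (M u w) × (∀ w' → w' ≢ w → M u w' ≡ + 0)
    row u = translate x u
          , subst IsUnit (sym (matrix-on s x z (translate x u) (sym (translate-involutive x u))))
                  (sgn-unit (s xor dot z (toBits (translate x u))))
          , λ w w≢ → matrix-off s x z {u} w (λ eq → w≢ (sym (translate-flip {x = x} eq)))
    column : ∀ w → ∃ λ u → IsUnit (M u w) × (∀ u' → u' ≢ u → M u' w ≡ + 0)
    column w = translate x w
             , subst IsUnit (sym (matrix-on s x z w refl)) (sgn-unit (s xor dot z (toBits w)))
             , λ u u≢ → matrix-off s x z {u} w u≢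

  product-sign : ∀ s (z : Vec Bool k) s' x' z' (w : Fin (2 ^ k)) →
    sgn (s xor dot z (toBits (translate x' w))) ℤ.* sgn (s' xor dot z' (toBits w))
      ≡ sgn (((s xor s') xor dot z x') xor dot (z ⊕ z') (toBits w))
  product-sign s z s' x' z' w =
    trans (sgn-xor (s xor dot z (toBits (translate x' w))) (s' xor dot z' (toBits w))) (cong sgn (begin
    (s xor dot z (toBits (translate x' w))) xor (s' xor dot z' w')
      ≡⟨ cong (λ v → (s xor dot z v) xor (s' xor dot z' w')) (toBits-translate x' w) ⟩
    (s xor dot z (x' ⊕ w')) xor (s' xor dot z' w')
      ≡⟨ cong (λ v → (s xor v) xor (s' xor dot z' w')) (dot-⊕ʳ z x' w') ⟩
    (s xor (dot z x' xor dot z w')) xor (s' xor dot z' w')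
      ≡⟨ solve 5 (λ s zx' zw s' z'w → (s ⊞ (zx' ⊞ zw)) ⊞ (s' ⊞ z'w) ⊜ ((s ⊞ s') ⊞ zx') ⊞ (zw ⊞ z'w))
               refl s (dot z x') (dot z w') s' (dot z' w') ⟩
    ((s xor s') xor dot z x') xor (dot z w' xor dot z' w')
      ≡⟨ cong (((s xor s') xor dot z x') xor_) (dot-⊕ˡ z z' w') ⟨
    ((s xor s') xor dot z x') xor dot (z ⊕ z') w' ∎))
    where
    open ≡-Reasoning
    w' : Vec Bool k
    w' = toBits w

  -- In the product of two monomial matrices only the middle index
  -- l = x' + w contributes to the (u , w) entry.
  matrix-hom : ∀ a b u w → matrix (a · b) u w ≡ (matrix a ⊗ matrix b) u w
  matrix-hom (s , x , z) (s' , x' , z') u w =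
    sym (trans (sumFin-single (2 ^ k) _ middle off-middle) (at-middle (u ≟ translate (x ⊕ x') w)))
    where
    middle : Fin (2 ^ k)
    middle = translate x' w
    off-middle : ∀ l → l ≢ middle → matrix (s , x , z) u l ℤ.* matrix (s' , x' , z') l w ≡ + 0
    off-middle l l≢ = trans (cong (matrix (s , x , z) u l ℤ.*_) (matrix-off s' x' z' w l≢))
                            (ℤP.*-zeroʳ (matrix (s , x , z) u l))
    at-middle : Dec (u ≡ translate (x ⊕ x') w) →
      matrix (s , x , z) u middle ℤ.* matrix (s' , x' , z') middle w ≡ matrix ((s , x , z) · (s' , x' , z')) u w
    at-middle (yes on) =
      trans (cong₂ ℤ._*_ (matrix-on s x z middle (trans on (sym (translate-∘ x x' w)))) (matrix-on s' x' z' w refl))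
            (trans (product-sign s z s' x' z' w)
                   (sym (matrix-on ((s xor s') xor dot z x') (x ⊕ x') (z ⊕ z') w on)))
    at-middle (no off) =
      trans (cong (ℤ._* matrix (s' , x' , z') middle w)
                  (matrix-off s x z middle (λ on → off (trans on (translate-∘ x x' w)))))
            (sym (matrix-off ((s xor s') xor dot z x') (x ⊕ x') (z ⊕ z') w off))

  matrix-minus-one : ∀ u w → matrix (sign true) u w ≡ negI (2 ^ k) u w
  matrix-minus-one u w rewrite translate-0 {k} w | dot-0ˡ (toBits {k} w) = refl

  pauliRemrep : Remrep (pauliSigned {k}) (2 ^ k)
  pauliRemrep = record
    { φ      = matrix
    ; φ-SP   = matrix-SP
    ; φ-cong = λ { refl u w → refl }
    ; φ-hom  = matrix-hom
    ; φ-neg  = matrix-minus-one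
    }

-- If Q (F p ⊕S F q) = 1 for
-- p ≠ q, the Pauli elements α_p = (0 , F p) satisfy (α_p α_q⁻¹)² = -1, which
-- is exactly what the orthogonal design needs.  A base family of 8 labels on
-- 3 qubits is doubled repeatedly; a doubling turns k qubits into 2k + 1.

IsAntiFamily : ∀ {m k} → (Vec Bool m → Sym k) → Set
IsAntiFamily F = ∀ p q → p ≢ q → Q (F p ⊕S F q) ≡ true

infixr 5 _++S_

_++S_ : ∀ {a b} → Sym a → Sym b → Sym (a + b)
u ++S v = proj₁ u ++ proj₁ v , proj₂ u ++ proj₂ v

Q-split3 : ∀ {a b c} (u u' : Sym a) (v v' : Sym b) (w w' : Sym c) →
  Q ((u ++S v ++S w) ⊕S (u' ++S v' ++S w')) ≡ Q (u ⊕S u') xor (Q (v ⊕S v') xor Q (w ⊕S w'))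
Q-split3 (x₁ , z₁) (x₁' , z₁') (x₂ , z₂) (x₂' , z₂') (x₃ , z₃) (x₃' , z₃')
  rewrite ⊕-++ x₁ x₁' (x₂ ++ x₃) (x₂' ++ x₃') | ⊕-++ x₂ x₂' x₃ x₃'
        | ⊕-++ z₁ z₁' (z₂ ++ z₃) (z₂' ++ z₃') | ⊕-++ z₂ z₂' z₃ z₃'
        | dot-++ (z₁ ⊕ z₁') (x₁ ⊕ x₁') ((z₂ ⊕ z₂') ++ (z₃ ⊕ z₃')) ((x₂ ⊕ x₂') ++ (x₃ ⊕ x₃'))
        | dot-++ (z₂ ⊕ z₂') (x₂ ⊕ x₂') (z₃ ⊕ z₃') (x₃ ⊕ x₃') = refl

Q-0S⊕0S : ∀ {k} → Q (0S {k} ⊕S 0S) ≡ false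
Q-0S⊕0S {k} = trans (cong Q (⊕S-self (0S {k}))) (β-0ˡ (0S {k}))

-- Labels of the identity and of X, Y = XZ, Z on one extra qubit.  A member p
-- of the doubled family gets the extra label  left (Q (F p))  or
-- right (Q (F p)), chosen so that the three blocks of Q always sum to 1.
left right : Bool → Sym 1
left false  = (false ∷ []) , (false ∷ [])
left true   = (true ∷ [])  , (false ∷ [])
right false = (true ∷ [])  , (true ∷ [])
right true  = (false ∷ []) , (true ∷ [])

left-left : ∀ a b → Q (left a ⊕S left b) ≡ false
left-left false false = refl
left-left false true  = refl
left-left true  false = refl
left-left true  true  = refl

right-right : ∀ a b → Q (right a ⊕S right b) ≡ false
right-right false false = refl
right-right false true  = refl
right-right true  false = refl
right-right true  true  = refl

left-right : ∀ a b → a xor (b xor Q (left a ⊕S right b)) ≡ true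
left-right false false = refl
left-right false true  = refl
left-right true  false = refl
left-right true  true  = refl

-- Members tagged 0 keep their label in the first block, members tagged 1
-- move it to the second block; the last qubit repairs the mixed pairs.
double : ∀ {m k} → (Vec Bool m → Sym k) → Vec Bool (suc m) → Sym (k + (k + 1))
double {k = k} F (false ∷ p) = F p ++S 0S {k} ++S left (Q (F p))
double {k = k} F (true ∷ p)  = 0S {k} ++S F p ++S right (Q (F p))

-- Pairs within one half anticommute through the old family, the extra
-- qubits contributing nothing; mixed pairs anticommute by left-right.
double-anti : ∀ {m k} (F : Vec Bool m → Sym k) → IsAntiFamily F → IsAntiFamily (double F)
double-anti {k = k} F anti (false ∷ p) (false ∷ q) p≢q =
  trans (Q-split3 (F p) (F q) (0S {k}) 0S (left (Q (F p))) (left (Q (F q))))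
        (cong₂ _xor_ (anti p q (p≢q ∘ cong (false ∷_))) (cong₂ _xor_ (Q-0S⊕0S {k}) (left-left (Q (F p)) (Q (F q)))))
double-anti {k = k} F anti (true ∷ p) (true ∷ q) p≢q =
  trans (Q-split3 (0S {k}) 0S (F p) (F q) (right (Q (F p))) (right (Q (F q))))
        (cong₂ _xor_ (Q-0S⊕0S {k}) (cong₂ _xor_ (anti p q (p≢q ∘ cong (true ∷_))) (right-right (Q (F p)) (Q (F q)))))
double-anti {k = k} F anti (false ∷ p) (true ∷ q) _ = mixed p q
  where
  mixed : ∀ p q → Q (double F (false ∷ p) ⊕S double F (true ∷ q)) ≡ true
  mixed p q =
    trans (Q-split3 (F p) (0S {k}) (0S {k}) (F q) (left (Q (F p))) (right (Q (F q))))
          (trans (cong₂ _xor_ (cong Q (⊕S-identityʳ (F p)))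
                              (cong (_xor Q (left (Q (F p)) ⊕S right (Q (F q)))) (cong Q (⊕S-identityˡ (F q)))))
                 (left-right (Q (F p)) (Q (F q))))
double-anti {k = k} F anti (true ∷ p) (false ∷ q) _ =
  trans (cong Q (⊕S-comm (double F (true ∷ p)) (double F (false ∷ q))))
        (double-anti {k = k} F anti (false ∷ q) (true ∷ p) λ ())

every : ∀ k → (Vec Bool k → Bool) → Bool
every zero    f = f []
every (suc k) f = every k (f ∘ (false ∷_)) ∧ every k (f ∘ (true ∷_))

every-sound : ∀ k (f : Vec Bool k → Bool) → T (every k f) → ∀ v → T (f v)
every-sound zero    f holds []          = holds
every-sound (suc k) f holds (false ∷ v) = every-sound k (f ∘ (false ∷_)) (proj₁ (Equivalence.to T-∧ holds)) v
every-sound (suc k) f holds (true ∷ v)  = every-sound k (f ∘ (true ∷_)) (proj₂ (Equivalence.to T-∧ holds)) v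

-- Eight pairwise anticommuting labels on three qubits: p ↦ (p , zpart p).
zpart : Vec Bool 3 → Vec Bool 3
zpart (false ∷ false ∷ false ∷ []) = false ∷ false ∷ false ∷ []
zpart (false ∷ false ∷ true ∷ [])  = false ∷ false ∷ true ∷ []
zpart (false ∷ true ∷ false ∷ [])  = false ∷ true ∷ true ∷ []
zpart (false ∷ true ∷ true ∷ [])   = true ∷ true ∷ false ∷ []
zpart (true ∷ false ∷ false ∷ [])  = true ∷ true ∷ true ∷ []
zpart (true ∷ false ∷ true ∷ [])   = true ∷ false ∷ false ∷ []
zpart (true ∷ true ∷ false ∷ [])   = true ∷ false ∷ true ∷ []
zpart (true ∷ true ∷ true ∷ [])    = false ∷ true ∷ false ∷ []

base : Vec Bool 3 → Sym 3
base p = p , zpart p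

base-pair-ok : Vec Bool 3 → Vec Bool 3 → Bool
base-pair-ok p q = does (Vec.≡-dec Data.Bool.Properties._≟_ p q) ∨ Q (base p ⊕S base q)

base-all-pairs : T (every 3 λ p → every 3 (base-pair-ok p))
base-all-pairs = tt

base-anti : IsAntiFamily base
base-anti p q p≢q
  with Vec.≡-dec Data.Bool.Properties._≟_ p q
     | every-sound 3 (base-pair-ok p) (every-sound 3 (λ p → every 3 (base-pair-ok p)) base-all-pairs p) q
... | yes p≡q | _     = ⊥-elim (p≢q p≡q)
... | no _    | holds = Equivalence.to T-≡ holds

dim : ℕ → ℕ
dim zero    = 3
dim (suc t) = dim t + (dim t + 1)

dim-formula : ∀ t → suc (dim t) ≡ 2 ^ suc (suc t)
dim-formula zero    = refl
dim-formula (suc t) = begin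
  suc (dim t + (dim t + 1))         ≡⟨ cong (λ d → suc (dim t + d)) (ℕ.+-comm (dim t) 1) ⟩
  suc (dim t) + suc (dim t)         ≡⟨ cong (λ d → d + d) (dim-formula t) ⟩
  2 ^ suc (suc t) + 2 ^ suc (suc t) ≡⟨ cong (λ d → 2 ^ suc (suc t) + d) (ℕ.+-identityʳ (2 ^ suc (suc t))) ⟨
  2 ^ suc (suc (suc t))             ∎
  where open ≡-Reasoning

family : ∀ t → Vec Bool (3 + t) → Sym (dim t)
family zero    = base
family (suc t) = double (family t)

family-anti : ∀ t → IsAntiFamily (family t)
family-anti zero    = base-anti
family-anti (suc t) = double-anti (family t) (family-anti t)

-- In a signed group, an element g with g² = -1 satisfies g⁻¹ = -g.  Hence two
-- elements whose quotient squares to -1 are anti-amicable: b a⁻¹ = -(a b⁻¹).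
module SignedGroupFacts {c ℓ} (S : SignedGroup c ℓ) where
  open SignedGroup S
  open import Algebra.Properties.Group group using (⁻¹-anti-homo-∙; ⁻¹-involutive)
  open import Relation.Binary.Reasoning.Setoid setoid

  inverse-of-root : ∀ g → g ∙ g ≈ -1g → g ⁻¹ ≈ -1g ∙ g
  inverse-of-root g g²≈-1 = begin
    g ⁻¹                    ≈⟨ identityʳ (g ⁻¹) ⟨
    g ⁻¹ ∙ ε                ≈⟨ ∙-congˡ -1g² ⟨
    g ⁻¹ ∙ (-1g ∙ -1g)      ≈⟨ ∙-congˡ (∙-congʳ g²≈-1) ⟨
    g ⁻¹ ∙ ((g ∙ g) ∙ -1g)  ≈⟨ ∙-congˡ (assoc g g -1g) ⟩
    g ⁻¹ ∙ (g ∙ (g ∙ -1g))  ≈⟨ assoc (g ⁻¹) g (g ∙ -1g) ⟨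
    (g ⁻¹ ∙ g) ∙ (g ∙ -1g)  ≈⟨ ∙-congʳ (inverseˡ g) ⟩
    ε ∙ (g ∙ -1g)           ≈⟨ identityˡ (g ∙ -1g) ⟩
    g ∙ -1g                 ≈⟨ -1g-central g ⟨
    -1g ∙ g                 ∎

  anti-amicable : ∀ a b → (a ∙ b ⁻¹) ∙ (a ∙ b ⁻¹) ≈ -1g → b ∙ a ⁻¹ ≈ -1g ∙ (a ∙ b ⁻¹)
  anti-amicable a b square≈-1 = begin
    b ∙ a ⁻¹        ≈⟨ ∙-congʳ (⁻¹-involutive b) ⟨
    b ⁻¹ ⁻¹ ∙ a ⁻¹  ≈⟨ ⁻¹-anti-homo-∙ a (b ⁻¹) ⟨
    (a ∙ b ⁻¹) ⁻¹   ≈⟨ inverse-of-root (a ∙ b ⁻¹) square≈-1 ⟩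
    -1g ∙ (a ∙ b ⁻¹) ∎

indicator : ∀ {m} → Fin m → ℤ → Fin m → ℤ
indicator l r c = if does (c ≟ l) then r else + 0

sumFin-indicator : ∀ m (l : Fin m) r → sumFin m (indicator l r) ≡ r
sumFin-indicator m l r =
  trans (sumFin-single m (indicator l r) l (λ l' l'≢l → if-no (l' ≟ l) l'≢l)) (if-yes (l ≟ l) refl)

sumFin-+ : ∀ m (f g : Fin m → ℤ) → sumFin m (λ c → f c ℤ.+ g c) ≡ sumFin m f ℤ.+ sumFin m g
sumFin-+ zero    f g = refl
sumFin-+ (suc m) f g =
  trans (cong₂ ℤ._+_ (refl {x = f Fin.zero ℤ.+ g Fin.zero}) (sumFin-+ m (f ∘ Fin.suc) (g ∘ Fin.suc)))
        (interchange (f Fin.zero) (g Fin.zero) (sumFin m (f ∘ Fin.suc)) (sumFin m (g ∘ Fin.suc)))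
  where open import Algebra.Properties.CommutativeSemigroup ℤP.+-commutativeSemigroup using (interchange)

module DesignCoefficients {c ℓ} (S : SignedGroup c ℓ) where
  open SignedGroup S using (Carrier; _∙_; _⁻¹; ε)
  open SignedGroupRing S
  open SOD-Defs S

  single : Carrier → ℤ → RS
  single w r = (w , r) ∷ []

  ≡⇒~ : ∀ {L L'} → L ≡ L' → L ~ L'
  ≡⇒~ refl = ~-refl

  ~-++ʳ : ∀ {L L'} M → L ~ L' → (L List.++ M) ~ (L' List.++ M)
  ~-++ʳ M ~-refl          = ~-refl
  ~-++ʳ M (~-sym d)       = ~-sym (~-++ʳ M d)
  ~-++ʳ M (~-trans d d')  = ~-trans (~-++ʳ M d) (~-++ʳ M d')
  ~-++ʳ M (~-perm p)      = ~-perm (++⁺ʳ M p)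
  ~-++ʳ M (~-∷ d)         = ~-∷ (~-++ʳ M d)
  ~-++ʳ M (~-el s≈t)      = ~-el s≈t
  ~-++ʳ M ~-sign          = ~-sign
  ~-++ʳ M ~-merge         = ~-merge
  ~-++ʳ M ~-zero          = ~-zero

  collect : ∀ {B : Set} w (f : B → RS) (κ : B → ℤ) → (∀ b → f b ~ single w (κ b)) →
            ∀ m (g : Fin m → B) → concatMap f (tabulate g) ~ single w (sumFin m (κ ∘ g))
  collect w f κ each zero    g = ~-sym ~-zero
  collect w f κ each (suc m) g =
    ~-trans (~-++ʳ (concatMap f (tabulate (g ∘ Fin.suc))) (each (g Fin.zero)))
            (~-trans (~-∷ (collect w f κ each m (g ∘ Fin.suc))) ~-merge)

  sameMonomial-ij : ∀ {k} (i j : Fin k) → toℕ i ≤ toℕ j → sameMonomial i j i j ≡ true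
  sameMonomial-ij i j i≤j
    rewrite Equivalence.to T-≡ (ℕ.≤⇒≤ᵇ i≤j) | dec-true (i ≟ i) refl | dec-true (j ≟ j) refl = refl

  sameMonomial-ji : ∀ {k} (i j : Fin k) → toℕ i ≤ toℕ j → i ≢ j → sameMonomial j i i j ≡ true
  sameMonomial-ji i j i≤j i≢j with toℕ j ≤ᵇ toℕ i in j≤ᵇi
  ... | true  = ⊥-elim (i≢j (toℕ-injective (ℕ.≤-antisym i≤j (ℕ.≤ᵇ⇒≤ (toℕ j) (toℕ i) (subst T (sym j≤ᵇi) tt)))))
  ... | false rewrite dec-true (i ≟ i) refl | dec-true (j ≟ j) refl = refl

  sameMonomial-other : ∀ {k} (p q i j : Fin k) → (p ≡ i → q ≢ j) → (p ≡ j → q ≢ i) → sameMonomial p q i j ≡ false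
  sameMonomial-other p q i j not-ij not-ji with toℕ p ≤ᵇ toℕ q
  ... | true with p ≟ i | q ≟ j
  ...   | yes p≡i | yes q≡j = ⊥-elim (not-ij p≡i q≡j)
  ...   | yes _   | no _    = refl
  ...   | no _    | _       = refl
  sameMonomial-other p q i j not-ij not-ji | false with q ≟ i | p ≟ j
  ...   | yes q≡i | yes p≡j = ⊥-elim (not-ji p≡j q≡i)
  ...   | yes _   | no _    = refl
  ...   | no _    | _       = refl

  entry : ∀ {k} → (Fin k → Carrier) → Fin k → Entry k
  entry α p = just (α p , p)

  term-ij : ∀ {k} (α : Fin k → Carrier) {p q i j : Fin k} → toℕ i ≤ toℕ j → p ≡ i → q ≡ j →
            term (entry α p) (entry α q) i j ≡ single (α i ∙ α j ⁻¹) (+ 1)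
  term-ij α {i = i} {j} i≤j refl refl rewrite sameMonomial-ij i j i≤j = refl

  term-ji : ∀ {k} (α : Fin k → Carrier) {p q i j : Fin k} → toℕ i ≤ toℕ j → i ≢ j → p ≡ j → q ≡ i →
            term (entry α p) (entry α q) i j ≡ single (α j ∙ α i ⁻¹) (+ 1)
  term-ji α {i = i} {j} i≤j i≢j refl refl rewrite sameMonomial-ji i j i≤j i≢j = refl

  term-other : ∀ {k} (α : Fin k → Carrier) {p q i j : Fin k} → (p ≡ i → q ≢ j) → (p ≡ j → q ≢ i) →
               term (entry α p) (entry α q) i j ≡ []
  term-other α {p} {q} {i} {j} not-ij not-ji rewrite sameMonomial-other p q i j not-ij not-ji = refl

  target-diagonal : ∀ {n k} {a b : Fin n} {i j : Fin k} → a ≡ b → i ≡ j →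
                    coeffTarget (λ _ → 1) a b i j ≡ single ε (+ 1)
  target-diagonal {a = a} {b} {i} {j} a≡b i≡j rewrite dec-true (a ≟ b) a≡b | dec-true (i ≟ j) i≡j = refl

  target-off : ∀ {n k} {a b : Fin n} {i j : Fin k} → ¬ (a ≡ b × i ≡ j) → coeffTarget (λ _ → 1) a b i j ≡ []
  target-off {a = a} {b} {i} {j} off with a ≟ b | i ≟ j
  ... | yes a≡b | yes i≡j = ⊥-elim (off (a≡b , i≡j))
  ... | yes _   | no _    = refl
  ... | no _    | _       = refl

-- If the quotients α_p α_q⁻¹ (p ≠ q) all square to -1, then in (X X*)_ab the
-- contributions of the columns c₀ = a + i and c₁ = a + j to x_i x_j cancel
-- unless a = b and i = j, so X is an SOD(2ⁿ; 1_(2ⁿ), S).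
module GroupDevelopedDesign {c ℓ} (S : SignedGroup c ℓ) (n : ℕ) where
  open SignedGroup S using (Carrier; _≈_; _∙_; _⁻¹; ε; -1g; inverseʳ)
  open SignedGroupRing S
  open SOD-Defs S
  open DesignCoefficients S
  open SignedGroupFacts S using (anti-amicable)

  N : ℕ
  N = 2 ^ n

  bits : Fin N → Vec Bool n
  bits = toBits {n}

  infixr 6 _⊻_

  _⊻_ : Fin N → Fin N → Fin N
  a ⊻ c = translate (bits a) c

  ⊻-cancel : ∀ a c → a ⊻ a ⊻ c ≡ c
  ⊻-cancel a c = translate-involutive (bits a) c

  ⊻-solve : ∀ a {c x} → a ⊻ c ≡ x → c ≡ a ⊻ x
  ⊻-solve a {c} eq = trans (sym (⊻-cancel a c)) (cong (a ⊻_) eq)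

  ⊻-swap : ∀ a b {i j} → b ⊻ a ⊻ i ≡ j → b ⊻ a ⊻ j ≡ i
  ⊻-swap a b {i} {j} eq = begin
    b ⊻ a ⊻ j                     ≡⟨ translate-∘ (bits b) (bits a) j ⟩
    translate (bits b ⊕ bits a) j ≡⟨ translate-flip {x = bits b ⊕ bits a} (trans (sym eq) (translate-∘ (bits b) (bits a) i)) ⟩
    i                             ∎
    where open ≡-Reasoning

  ⊻-fixed : ∀ a b i → b ⊻ a ⊻ i ≡ i → b ≡ a
  ⊻-fixed a b i eq = sym (toBits-injective (translate-free {x = bits a} i (⊻-solve b eq)))

  design : (Fin N → Carrier) → Mat N N
  design α a c = entry α (a ⊻ c)

  module Coefficient (α : Fin N → Carrier)
                     (anti : ∀ p q → p ≢ q → α q ∙ α p ⁻¹ ≈ -1g ∙ (α p ∙ α q ⁻¹))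
                     (a b i j : Fin N) (i≤j : toℕ i ≤ toℕ j) where

    -- every contributing product is ± w
    w : Carrier
    w = α i ∙ α j ⁻¹

    -- the columns in which row a carries x_i and x_j respectively
    c₀ c₁ : Fin N
    c₀ = a ⊻ i
    c₁ = a ⊻ j

    -- their contributions: +1 if row b carries x_j in column c₀, and
    -- -1 if (for i ≠ j) row b carries x_i in column c₁
    A B : ℤ
    A = if does (b ⊻ c₀ ≟ j) then + 1 else + 0
    B = if does (i ≟ j) then + 0 else (if does (b ⊻ c₁ ≟ i) then - (+ 1) else + 0)

    -- the multiple of w contributed by column c
    κ : Fin N → ℤ
    κ c = indicator c₀ A c ℤ.+ indicator c₁ B c

    c₀≡c₁ : c₀ ≡ c₁ → i ≡ j
    c₀≡c₁ eq = trans (sym (⊻-cancel a i)) (trans (cong (a ⊻_) eq) (⊻-cancel a j))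

    κ-c₀ : κ c₀ ≡ A
    κ-c₀ = trans (cong₂ ℤ._+_ (if-yes (c₀ ≟ c₀) refl) second) (ℤP.+-identityʳ A)
      where
      second : indicator c₁ B c₀ ≡ + 0
      second with c₀ ≟ c₁
      ... | yes eq = if-yes (i ≟ j) (c₀≡c₁ eq)
      ... | no _   = refl

    κ-c₁ : c₁ ≢ c₀ → κ c₁ ≡ B
    κ-c₁ c₁≢c₀ = trans (cong₂ ℤ._+_ (if-no (c₁ ≟ c₀) c₁≢c₀) (if-yes (c₁ ≟ c₁) refl)) (ℤP.+-identityˡ B)

    κ-other : ∀ c → c ≢ c₀ → c ≢ c₁ → κ c ≡ + 0
    κ-other c c≢c₀ c≢c₁ = cong₂ ℤ._+_ (if-no (c ≟ c₀) c≢c₀) (if-no (c ≟ c₁) c≢c₁)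

    -- Column c₀ contributes A w; column c₁ contributes B w, the sign coming
    -- from anti-amicability; every other column contributes nothing.
    column-c₀ : term (design α a c₀) (design α b c₀) i j ~ single w A
    column-c₀ = by-cases (b ⊻ c₀ ≟ j)
      where
      p≡i : a ⊻ c₀ ≡ i
      p≡i = ⊻-cancel a i
      by-cases : Dec (b ⊻ c₀ ≡ j) → term (design α a c₀) (design α b c₀) i j ~ single w A
      by-cases (yes q≡j) =
        ~-trans (≡⇒~ (term-ij α i≤j p≡i q≡j)) (≡⇒~ (cong (single w) (sym (if-yes (b ⊻ c₀ ≟ j) q≡j))))
      by-cases (no q≢j) =
        ~-trans (≡⇒~ (term-other α (λ _ → q≢j) (λ p≡j q≡i → q≢j (trans q≡i (trans (sym p≡i) p≡j)))))
                (~-trans (~-sym ~-zero) (≡⇒~ (cong (single w) (sym (if-no (b ⊻ c₀ ≟ j) q≢j)))))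

    column-c₁ : i ≢ j → term (design α a c₁) (design α b c₁) i j ~ single w B
    column-c₁ i≢j = by-cases (b ⊻ c₁ ≟ i)
      where
      p≡j : a ⊻ c₁ ≡ j
      p≡j = ⊻-cancel a j
      by-cases : Dec (b ⊻ c₁ ≡ i) → term (design α a c₁) (design α b c₁) i j ~ single w B
      by-cases (yes q≡i) =
        ~-trans (≡⇒~ (term-ji α i≤j i≢j p≡j q≡i))
          (~-trans (~-el (anti i j i≢j))
            (~-trans ~-sign (≡⇒~ (cong (single w) (sym (trans (if-no (i ≟ j) i≢j) (if-yes (b ⊻ c₁ ≟ i) q≡i)))))))
      by-cases (no q≢i) =
        ~-trans (≡⇒~ (term-other α (λ p≡i _ → i≢j (trans (sym p≡i) p≡j)) (λ _ → q≢i)))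
          (~-trans (~-sym ~-zero) (≡⇒~ (cong (single w) (sym (trans (if-no (i ≟ j) i≢j) (if-no (b ⊻ c₁ ≟ i) q≢i))))))

    column-other : ∀ c → c ≢ c₀ → c ≢ c₁ → term (design α a c) (design α b c) i j ≡ []
    column-other c c≢c₀ c≢c₁ = term-other α (λ p≡i _ → c≢c₀ (⊻-solve a p≡i)) (λ p≡j _ → c≢c₁ (⊻-solve a p≡j))

    column : ∀ c → term (design α a c) (design α b c) i j ~ single w (κ c)
    column c = by-cases (c ≟ c₀) (c ≟ c₁)
      where
      by-cases : Dec (c ≡ c₀) → Dec (c ≡ c₁) → term (design α a c) (design α b c) i j ~ single w (κ c)
      by-cases (yes refl) _          = ~-trans column-c₀ (≡⇒~ (cong (single w) (sym κ-c₀)))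
      by-cases (no c≢c₀)  (yes refl) =
        ~-trans (column-c₁ (λ i≡j → c≢c₀ (cong (a ⊻_) (sym i≡j)))) (≡⇒~ (cong (single w) (sym (κ-c₁ c≢c₀))))
      by-cases (no c≢c₀)  (no c≢c₁)  =
        ~-trans (≡⇒~ (column-other c c≢c₀ c≢c₁))
                (~-trans (~-sym ~-zero) (≡⇒~ (cong (single w) (sym (κ-other c c≢c₀ c≢c₁)))))

    column-sum : sumFin N κ ≡ A ℤ.+ B
    column-sum = trans (sumFin-+ N (indicator c₀ A) (indicator c₁ B))
                       (cong₂ ℤ._+_ (sumFin-indicator N c₀ A) (sumFin-indicator N c₁ B))

    cancel-off-diagonal : i ≢ j → A ℤ.+ B ≡ + 0
    cancel-off-diagonal i≢j = by-cases (b ⊻ c₀ ≟ j)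
      where
      by-cases : Dec (b ⊻ c₀ ≡ j) → A ℤ.+ B ≡ + 0
      by-cases (yes q≡j) = cong₂ ℤ._+_ (if-yes (b ⊻ c₀ ≟ j) q≡j)
                             (trans (if-no (i ≟ j) i≢j) (if-yes (b ⊻ c₁ ≟ i) (⊻-swap a b q≡j)))
      by-cases (no q≢j)  = cong₂ ℤ._+_ (if-no (b ⊻ c₀ ≟ j) q≢j)
                             (trans (if-no (i ≟ j) i≢j) (if-no (b ⊻ c₁ ≟ i) (q≢j ∘ ⊻-swap a b)))

    diagonal : i ≡ j → a ≡ b → A ℤ.+ B ≡ + 1
    diagonal i≡j refl = cong₂ ℤ._+_ (if-yes (b ⊻ c₀ ≟ j) (trans (⊻-cancel a i) i≡j)) (if-yes (i ≟ j) i≡j)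

    off-diagonal : i ≡ j → a ≢ b → A ℤ.+ B ≡ + 0
    off-diagonal i≡j a≢b =
      cong₂ ℤ._+_ (if-no (b ⊻ c₀ ≟ j) (λ q≡j → a≢b (sym (⊻-fixed a b i (trans q≡j (sym i≡j))))))
                  (if-yes (i ≟ j) i≡j)

    resolve : single w (A ℤ.+ B) ~ coeffTarget (λ _ → 1) a b i j
    resolve = by-cases (a ≟ b) (i ≟ j)
      where
      vanish : A ℤ.+ B ≡ + 0 → ¬ (a ≡ b × i ≡ j) → single w (A ℤ.+ B) ~ coeffTarget (λ _ → 1) a b i j
      vanish sum≡0 off = ~-trans (≡⇒~ (cong (single w) sum≡0)) (~-trans ~-zero (≡⇒~ (sym (target-off off))))
      by-cases : Dec (a ≡ b) → Dec (i ≡ j) → single w (A ℤ.+ B) ~ coeffTarget (λ _ → 1) a b i j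
      by-cases (yes a≡b) (yes i≡j) =
        ~-trans (≡⇒~ (cong (single w) (diagonal i≡j a≡b)))
          (~-trans (~-el (subst (λ l → α i ∙ α l ⁻¹ ≈ ε) i≡j (inverseʳ (α i))))
                   (≡⇒~ (sym (target-diagonal a≡b i≡j))))
      by-cases (no a≢b)  (yes i≡j) = vanish (off-diagonal i≡j a≢b) (a≢b ∘ proj₁)
      by-cases _         (no i≢j)  = vanish (cancel-off-diagonal i≢j) (i≢j ∘ proj₂)

    coefficient : coeffXX* (design α) a b i j ~ coeffTarget (λ _ → 1) a b i j
    coefficient =
      ~-trans (collect w (λ c → term (design α a c) (design α b c) i j) κ column N (λ c → c))
              (subst (λ r → single w r ~ coeffTarget (λ _ → 1) a b i j) (sym column-sum) resolve)

  design-isSOD : (α : Fin N → Carrier) → (∀ p q → p ≢ q → (α p ∙ α q ⁻¹) ∙ (α p ∙ α q ⁻¹) ≈ -1g) →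
                 IsSOD N N (λ _ → 1) (design α)
  design-isSOD α square≈-1 =
    (λ _ → s≤s z≤n) ,
    λ a b i j i≤j → Coefficient.coefficient α (λ p q p≢q → anti-amicable (α p) (α q) (square≈-1 p q p≢q)) a b i j i≤j

module PauliDesign (t : ℕ) where
  open GroupDevelopedDesign (pauliSigned {dim t}) (3 + t) using (design; design-isSOD)
  open SOD-Defs (pauliSigned {dim t}) using (Mat; IsSOD)

  α : Fin (2 ^ (3 + t)) → Pauli (dim t)
  α p = false , family t (toBits p)

  X : Mat (2 ^ (3 + t)) (2 ^ (3 + t))
  X = design α

  X-isSOD : IsSOD (2 ^ (3 + t)) (2 ^ (3 + t)) (λ _ → 1) X
  X-isSOD = design-isSOD α λ p q p≢q →
    quotient-square false false (family t (toBits p)) (family t (toBits q))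
      (family-anti t (toBits p) (toBits q) (p≢q ∘ toBits-injective))

theorem10 : (n : ℕ) → 2 < n →
    Σ (SignedGroup 0ℓ 0ℓ) λ S →
      Σ (SOD-Defs.Mat S (2 ^ n) (2 ^ n)) (λ X →
        SOD-Defs.IsSOD S (2 ^ n) (2 ^ n) (λ _ → 1) X)
      × Remrep S (2 ^ (2 ^ (n ∸ 1) ∸ 1))
theorem10 zero ()
theorem10 (suc zero) (s≤s ())
theorem10 (suc (suc zero)) (s≤s (s≤s ()))
-- For n = 3 + t: the Pauli group of rank dim t = 2 ^ (n - 1) - 1, the Pauli
-- design, and the Pauli representation.
theorem10 (suc (suc (suc t))) _ =
  pauliSigned {dim t} , (PauliDesign.X t , PauliDesign.X-isSOD t) ,
  subst (λ m → Remrep (pauliSigned {dim t}) (2 ^ m)) (cong (_∸ 1) (dim-formula t))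
        (PauliRepresentation.pauliRemrep (dim t))
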